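{- Let $R=\{1\}$ and $S=\{s_1,\ldots,s_m\}$ be a set of distinct integers with $s_i>1$ for all $i$, and let $I$ be a finite subset of $\mathbb{Z}^+\setminus(R\cup S)$. Then \[\lim_{n\to\infty}\frac{p_{R>S,I}(n)}{p_{RSI}(n)}=\prod_{i=1}^m\frac{s_i}{s_i+1}.\] In particular, if $S=\{2,3,\ldots,k\}$ with $k\ge 2$, then \[\lim_{n\to\infty}\frac{p_{R>S,I}(n)}{p_{RSI}(n)}=\frac{2}{k+1}.\]
   Context: For pairwise disjoint sets $R,S,I\subseteq\mathbb{Z}^+$, $p_{RSI}(n)$ denotes the number of partitions of $n$ all of whose parts lie in $R\cup S\cup I$, and $p_{R>S,I}(n)$ denotes the number of those partitions in which the number of parts lying in $R$ (counted with multiplicity) is strictly greater than the number of parts lying in $S$ (counted with multiplicity). -}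

module Defs where

open import Data.Nat as ℕ using (ℕ; zero; suc; _+_; _*_; _∸_; _≤_; _<_; _≤?_; _<?_)
open import Data.Integer using (+_)
open import Data.Rational as ℚ using (ℚ; 0ℚ; 1ℚ; ∣_∣; _-_)
open import Data.List using (List; []; _∷_; _++_; length; filter; concatMap; map; upTo; take; drop; foldr)
open import Data.Nat.ListAction using (sum)
open import Data.Product using (∃; Σ-syntax)

-- A partition whose parts lie in a finite set of (distinct, positive) parts
-- ps = [q₁, …, q_r] is encoded by its multiplicity vector [m₁, …, m_r]
-- (m_j = number of times q_j occurs), with Σ m_j * q_j = n.
-- `partitions ps n` enumerates all such multiplicity vectors (each exactly once).
partitions : List ℕ → ℕ → List (List ℕ)
partitions []       zero    = [] ∷ []
partitions []       (suc n) = []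
partitions (p ∷ ps) n =
  concatMap (λ k → step k (k * p ≤? n)) (upTo (suc n))
  where
  open import Relation.Nullary using (Dec; yes; no)
  step : (k : ℕ) → Dec (k * p ≤ n) → List (List ℕ)
  step k (yes _) = map (k ∷_) (partitions ps (n ∸ k * p))
  step k (no _)  = []

-- p_{RSI}(n): number of partitions of n with all parts in R ∪ S ∪ I
-- (R, S, I given as lists of distinct positive integers, pairwise disjoint).
pRSI : List ℕ → List ℕ → List ℕ → ℕ → ℕ
pRSI R S I n = length (partitions (R ++ S ++ I) n)

-- number of parts (with multiplicity) lying in R, resp. in S,
-- for a multiplicity vector aligned with R ++ S ++ I
partsInR : List ℕ → List ℕ → List ℕ
partsInR R m = take (length R) m

partsInS : List ℕ → List ℕ → List ℕ → List ℕ
partsInS R S m = take (length S) (drop (length R) m)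

pR>S,I : List ℕ → List ℕ → List ℕ → ℕ → ℕ
pR>S,I R S I n =
  length (filter (λ m → sum (partsInS R S m) <? sum (partsInR R m))
                 (partitions (R ++ S ++ I) n))

-- the rational number a / b (b = 0 never occurs in our use, it is sent to 0)
ratio : ℕ → ℕ → ℚ
ratio a zero    = 0ℚ
ratio a (suc b) = (+ a) ℚ./ suc b

_⟶_ : (ℕ → ℚ) → ℚ → Set
f ⟶ L = ∀ (ε : ℚ) → 0ℚ ℚ.< ε → ∃ λ N → ∀ n → N ≤ n → ∣ f n - L ∣ ℚ.< ε

prodRatio : List ℕ → ℚ
prodRatio S = foldr (λ s acc → ((+ s) ℚ./ suc s) ℚ.* acc) 1ℚ S

twoTo : ℕ → List ℕ
twoTo k = map (λ i → i + 2) (upTo (k ∸ 1))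

{-# OPTIONS --safe #-}
-- Deleting one 1 and
-- merging every part s ∈ S with a further 1 into s + 1 maps the partitions of n + 1 with more ones
-- than parts from S bijectively onto the partitions of n with parts in (S + 1) ∪ {1} ∪ I; here this
-- identity is obtained by induction on S from the recurrences satisfied by the counts.
-- Both counts are thus numbers of partitions of at most n into d positive parts W, and such a number
-- lies between n ^ d / κ W and (n + ΣW) ^ d / κ W, where κ W = d! ∏ W. As S ∪ I and (S + 1) ∪ I have
-- the same size, the ratio tends to κ (S ∪ I) / κ ((S + 1) ∪ I) = ∏ s / (s + 1).
module Submission where

open import Defs
open import Function using (_∘_)
open import Data.Empty using (⊥-elim)
open import Data.Unit using (tt)
open import Data.Bool using (true; false)
open import Data.Product using (_×_; _,_; ∃; map₂)
open import Data.Sum using (inj₁; inj₂)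
open import Relation.Nullary using (Dec; yes; no; ¬_; does)
open import Relation.Unary using (Decidable; _≐_)
open import Relation.Binary.PropositionalEquality
  using (_≡_; refl; sym; cong; cong₂; subst; subst₂)
  renaming (trans to ≡-trans)
open import Data.Nat
  using (ℕ; zero; suc; _+_; _*_; _∸_; _^_; _!; _≤_; _<_; _≤?_; _<?_; z≤n; s≤s; z<s; ∣_-_∣; NonZero; >-nonZero)
open import Data.Nat.Properties
open import Data.Nat.Induction using (<-rec)
open import Data.Nat.Tactic.RingSolver using (solve-∀)
open import Data.Nat.ListAction using (sum; product)
open import Data.Nat.ListAction.Properties using (product-++)
open import Data.Nat.Coprimality using (Coprime)
open import Data.Fin using (Fin; toℕ)
open import Algebra.Properties.CommutativeMonoid.Sum +-0-commutativeMonoid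
  using (sum-syntax; sum⁺-syntax; ∑-comm; sum-cong-≗; sum-replicate-zero)
open import Data.List using (List; []; _∷_; _++_; _∷ʳ_; length; filter; map; concatMap; upTo; applyUpTo; take)
import Data.List.Properties as List
open import Data.List.Relation.Unary.All as All using (All; _∷_)
import Data.List.Relation.Unary.All.Properties as All
open import Data.List.Relation.Unary.Unique.Propositional using (Unique)
open import Data.List.Membership.Propositional using (_∉_)
open import Data.List.Relation.Binary.Permutation.Propositional using (_↭_; refl; prep; swap; trans)
open import Data.List.Relation.Binary.Permutation.Propositional.Properties using (All-resp-↭; shift; ∷↭∷ʳ)
open import Data.Integer as ℤ using (+_; +[1+_]; -[1+_]; +0; _⊖_)
import Data.Integer.Properties as ℤ
open import Data.Rational as ℚ using (ℚ; mkℚ; _/_)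
import Data.Rational.Properties as ℚ
open import Data.Rational.Unnormalised as ℚᵘ using (mkℚᵘ; *<*)
import Data.Rational.Unnormalised.Properties as ℚᵘ

open ≤-Reasoning

-- Guarded sums

infixl 7 _when_

_when_ : ∀ {A : Set} → ℕ → Dec A → ℕ
x when yes _ = x
x when no _  = 0

module _ {A : Set} where

  when-yes : ∀ (d : Dec A) {x} → A → x when d ≡ x
  when-yes (yes _) _ = refl
  when-yes (no ¬a) a = ⊥-elim (¬a a)

  when-no : ∀ (d : Dec A) {x} → ¬ A → x when d ≡ 0
  when-no (yes a) ¬a = ⊥-elim (¬a a)
  when-no (no _)  _  = refl

  when-cong : ∀ (d : Dec A) {x y} → (A → x ≡ y) → x when d ≡ y when d
  when-cong (yes a) x≡y = x≡y a
  when-cong (no _)  _   = refl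

  when-cong₂ : ∀ {B : Set} (d : Dec A) (e : Dec B) {x y} → (A → B) → (B → A) → x ≡ y → x when d ≡ y when e
  when-cong₂ (yes _) (yes _) _   _   x≡y = x≡y
  when-cong₂ (yes a) (no ¬b) A→B _   _   = ⊥-elim (¬b (A→B a))
  when-cong₂ (no ¬a) (yes b) _   B→A _   = ⊥-elim (¬a (B→A b))
  when-cong₂ (no _)  (no _)  _   _   _   = refl

  ∑-when : ∀ N (f : Fin N → ℕ) (d : Dec A) → ∑[ i < N ] (f i when d) ≡ (∑[ i < N ] f i) when d
  ∑-when N f (yes _) = refl
  ∑-when N f (no _)  = sum-replicate-zero N

when-nested : ∀ a b n (f : ℕ → ℕ) →
  f (n ∸ a ∸ b) when (b ≤? n ∸ a) when (a ≤? n) ≡ f (n ∸ (a + b)) when (a + b ≤? n)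
when-nested a b n f with a ≤? n
... | yes a≤n = when-cong₂ (b ≤? n ∸ a) (a + b ≤? n)
  (λ b≤n∸a → subst (_≤ n) (+-comm b a) (m≤o∸n⇒m+n≤o b a≤n b≤n∸a))
  (λ a+b≤n → m+n≤o⇒m≤o∸n b (subst (_≤ n) (+-comm a b) a+b≤n))
  (cong f (∸-+-assoc n a b))
... | no a≰n = sym (when-no (a + b ≤? n) (a≰n ∘ m+n≤o⇒m≤o a))

when-nested-1 : ∀ a b n (f : ℕ → ℕ) →
  f (n ∸ a ∸ b ∸ 1) when (1 ≤? n ∸ a ∸ b) when (b ≤? n ∸ a) when (a ≤? n)
    ≡ f (n ∸ 1 ∸ (a + b)) when (a + b ≤? n ∸ 1) when (1 ≤? n)
when-nested-1 a b n f = begin-equality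
    f (n ∸ a ∸ b ∸ 1) when (1 ≤? n ∸ a ∸ b) when (b ≤? n ∸ a) when (a ≤? n)
  ≡⟨ when-nested a b n (λ x → f (x ∸ 1) when (1 ≤? x)) ⟩
    f (n ∸ (a + b) ∸ 1) when (1 ≤? n ∸ (a + b)) when (a + b ≤? n)
  ≡⟨ when-nested (a + b) 1 n f ⟩
    f (n ∸ (a + b + 1)) when (a + b + 1 ≤? n)
  ≡⟨ cong (λ m → f (n ∸ m) when (m ≤? n)) (+-comm (a + b) 1) ⟩
    f (n ∸ (1 + (a + b))) when (1 + (a + b) ≤? n)
  ≡⟨ when-nested 1 (a + b) n f ⟨
    f (n ∸ 1 ∸ (a + b)) when (a + b ≤? n ∸ 1) when (1 ≤? n) ∎

∑-vanishing : ∀ N (f : ℕ → ℕ) → (∀ i → f i ≡ 0) → ∑[ i < N ] f (toℕ i) ≡ 0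
∑-vanishing N f f≡0 = ≡-trans (sum-cong-≗ {N} (f≡0 ∘ toℕ)) (sum-replicate-zero N)

∑-extend : ∀ a b (f : ℕ → ℕ) → (∀ i → f (a + i) ≡ 0) → ∑[ i < a + b ] f (toℕ i) ≡ ∑[ i < a ] f (toℕ i)
∑-extend zero    b f f≡0 = ∑-vanishing b f f≡0
∑-extend (suc a) b f f≡0 = cong (_+_ (f 0)) (∑-extend a b (f ∘ suc) f≡0)

sum-map-applyUpTo : ∀ (h f : ℕ → ℕ) n → sum (map h (applyUpTo f n)) ≡ ∑[ i < n ] h (f (toℕ i))
sum-map-applyUpTo h f zero    = refl
sum-map-applyUpTo h f (suc n) = cong (_+_ (h (f 0))) (sum-map-applyUpTo h (f ∘ suc) n)

-- Summing over the multiplicity of one part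

splitTerm : ℕ → (ℕ → ℕ → ℕ) → ℕ → ℕ → ℕ
splitTerm p g n k = g k (n ∸ k * p) when (k * p ≤? n)

splitSum : ℕ → (ℕ → ℕ → ℕ) → ℕ → ℕ
splitSum p g n = ∑[ k ≤ n ] splitTerm p g n (toℕ k)

splitSum-cong : ∀ p {g h : ℕ → ℕ → ℕ} n → (∀ k r → g k r ≡ h k r) → splitSum p g n ≡ splitSum p h n
splitSum-cong p n g≡h = sum-cong-≗ {suc n} (λ k → cong (_when (toℕ k * p ≤? n)) (g≡h (toℕ k) (n ∸ toℕ k * p)))

splitSum-range : ∀ {p} → 1 ≤ p → ∀ g {n N} → n < N → ∑[ k < N ] splitTerm p g n (toℕ k) ≡ splitSum p g n
splitSum-range {p} p≥1 g {n} {N} n<N = begin-equality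
    ∑[ k < N ] splitTerm p g n (toℕ k)
  ≡⟨ cong (λ M → ∑[ k < M ] splitTerm p g n (toℕ k)) (sym (m+[n∸m]≡n n<N)) ⟩
    ∑[ k < suc n + (N ∸ suc n) ] splitTerm p g n (toℕ k)
  ≡⟨ ∑-extend (suc n) (N ∸ suc n) (splitTerm p g n) beyond-n ⟩
    splitSum p g n ∎
  where
  beyond-n : ∀ i → splitTerm p g n (suc n + i) ≡ 0
  beyond-n i = when-no ((suc n + i) * p ≤? n)
    (<⇒≱ (<-≤-trans (s≤s (m≤m+n n i)) (m≤m*n (suc n + i) p {{>-nonZero p≥1}})))

splitSum-peel : ∀ {p} → 1 ≤ p → ∀ g n → splitSum p g n ≡ g 0 n + splitSum p (g ∘ suc) (n ∸ p) when (p ≤? n)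
splitSum-peel {p} p≥1 g n = cong (_+_ (g 0 n)) (begin-equality
    ∑[ k < n ] splitTerm p g n (suc (toℕ k))
  ≡⟨ sum-cong-≗ {n} (λ k → when-nested p (toℕ k * p) n (g (suc (toℕ k)))) ⟨
    ∑[ k < n ] (splitTerm p (g ∘ suc) (n ∸ p) (toℕ k) when (p ≤? n))
  ≡⟨ ∑-when n _ (p ≤? n) ⟩
    (∑[ k < n ] splitTerm p (g ∘ suc) (n ∸ p) (toℕ k)) when (p ≤? n)
  ≡⟨ when-cong (p ≤? n) (λ p≤n → splitSum-range p≥1 (g ∘ suc) (∸-monoʳ-< p≥1 p≤n)) ⟩
    splitSum p (g ∘ suc) (n ∸ p) when (p ≤? n) ∎)

splitSum-peel-≤ : ∀ {p} → 1 ≤ p → ∀ g {n} → p ≤ n → splitSum p g n ≡ g 0 n + splitSum p (g ∘ suc) (n ∸ p)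
splitSum-peel-≤ {p} p≥1 g {n} p≤n = ≡-trans (splitSum-peel p≥1 g n) (cong (_+_ (g 0 n)) (when-yes (p ≤? n) p≤n))

splitSum-peel-< : ∀ {p} → 1 ≤ p → ∀ g {n} → n < p → splitSum p g n ≡ g 0 n
splitSum-peel-< {p} p≥1 g {n} n<p = begin-equality
    splitSum p g n                                 ≡⟨ splitSum-peel p≥1 g n ⟩
    g 0 n + splitSum p (g ∘ suc) (n ∸ p) when (p ≤? n) ≡⟨ cong (_+_ (g 0 n)) (when-no (p ≤? n) (<⇒≱ n<p)) ⟩
    g 0 n + 0                                      ≡⟨ +-identityʳ (g 0 n) ⟩
    g 0 n                                          ∎

splitSum-shift : ∀ {p} → 1 ≤ p → ∀ g → (∀ r → g 0 r ≡ 0) → ∀ j n →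
  splitSum p (λ k → g (k ∸ j)) n ≡ splitSum p g (n ∸ j * p) when (j * p ≤? n)
splitSum-shift     p≥1 g g0≡0 zero    n = refl
splitSum-shift {p} p≥1 g g0≡0 (suc j) n = begin-equality
    splitSum p (λ k → g (k ∸ suc j)) n
  ≡⟨ splitSum-peel p≥1 (λ k → g (k ∸ suc j)) n ⟩
    g 0 n + splitSum p (λ k → g (k ∸ j)) (n ∸ p) when (p ≤? n)
  ≡⟨ cong₂ (λ x y → x + y when (p ≤? n)) (g0≡0 n) (splitSum-shift p≥1 g g0≡0 j (n ∸ p)) ⟩
    splitSum p g (n ∸ p ∸ j * p) when (j * p ≤? n ∸ p) when (p ≤? n)
  ≡⟨ when-nested p (j * p) n (splitSum p g) ⟩
    splitSum p g (n ∸ suc j * p) when (suc j * p ≤? n) ∎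

splitSum₂ : ℕ → ℕ → (ℕ → ℕ → ℕ → ℕ) → ℕ → ℕ
splitSum₂ a b g n = ∑[ k ≤ n ] ∑[ j ≤ n ]
  (g (toℕ k) (toℕ j) (n ∸ (toℕ k * a + toℕ j * b)) when (toℕ k * a + toℕ j * b ≤? n))

splitSum-splitSum : ∀ a {b} → 1 ≤ b → ∀ g n → splitSum a (λ k → splitSum b (g k)) n ≡ splitSum₂ a b g n
splitSum-splitSum a {b} b≥1 g n = sum-cong-≗ {suc n} λ k → let ka = toℕ k * a in begin-equality
    splitSum b (g (toℕ k)) (n ∸ ka) when (ka ≤? n)
  ≡⟨ cong (_when (ka ≤? n)) (splitSum-range b≥1 (g (toℕ k)) (s≤s (m∸n≤m n ka))) ⟨
    (∑[ j ≤ n ] splitTerm b (g (toℕ k)) (n ∸ ka) (toℕ j)) when (ka ≤? n)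
  ≡⟨ ∑-when (suc n) (λ j → splitTerm b (g (toℕ k)) (n ∸ ka) (toℕ j)) (ka ≤? n) ⟨
    ∑[ j ≤ n ] (splitTerm b (g (toℕ k)) (n ∸ ka) (toℕ j) when (ka ≤? n))
  ≡⟨ sum-cong-≗ {suc n} (λ j → when-nested ka (toℕ j * b) n (g (toℕ k) (toℕ j))) ⟩
    ∑[ j ≤ n ] (g (toℕ k) (toℕ j) (n ∸ (ka + toℕ j * b)) when (ka + toℕ j * b ≤? n)) ∎

splitSum₂-comm : ∀ a b g n → splitSum₂ a b g n ≡ splitSum₂ b a (λ j k → g k j) n
splitSum₂-comm a b g n = ≡-trans
  (∑-comm {suc n} {suc n} (λ k j →
    g (toℕ k) (toℕ j) (n ∸ (toℕ k * a + toℕ j * b)) when (toℕ k * a + toℕ j * b ≤? n)))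
  (sum-cong-≗ {suc n} λ j → sum-cong-≗ {suc n} λ k →
    cong (λ m → g (toℕ k) (toℕ j) (n ∸ m) when (m ≤? n)) (+-comm (toℕ k * a) (toℕ j * b)))

splitSum-comm : ∀ {a b} → 1 ≤ a → 1 ≤ b → ∀ g n →
  splitSum a (λ k → splitSum b (g k)) n ≡ splitSum b (λ j → splitSum a (λ k → g k j)) n
splitSum-comm {a} {b} a≥1 b≥1 g n = begin-equality
  splitSum a (λ k → splitSum b (g k)) n           ≡⟨ splitSum-splitSum a b≥1 g n ⟩
  splitSum₂ a b g n                               ≡⟨ splitSum₂-comm a b g n ⟩
  splitSum₂ b a (λ j k → g k j) n                 ≡⟨ splitSum-splitSum b a≥1 (λ j k → g k j) n ⟨
  splitSum b (λ j → splitSum a (λ k → g k j)) n   ∎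

-- Counting partitions

length-filter-concatMap : ∀ {A B : Set} {P : B → Set} (P? : Decidable P) (f : A → List B) xs →
  length (filter P? (concatMap f xs)) ≡ sum (map (length ∘ filter P? ∘ f) xs)
length-filter-concatMap P? f []       = refl
length-filter-concatMap P? f (x ∷ xs) = begin-equality
  length (filter P? (f x ++ concatMap f xs))                  ≡⟨ cong length (List.filter-++ P? (f x) _) ⟩
  length (filter P? (f x) ++ filter P? (concatMap f xs))      ≡⟨ List.length-++ (filter P? (f x)) ⟩
  length (filter P? (f x)) + length (filter P? (concatMap f xs))
    ≡⟨ cong (_+_ (length (filter P? (f x)))) (length-filter-concatMap P? f xs) ⟩
  length (filter P? (f x)) + sum (map (length ∘ filter P? ∘ f) xs) ∎

length-filter-map : ∀ {A B : Set} {P : B → Set} (P? : Decidable P) (f : A → B) xs →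
  length (filter P? (map f xs)) ≡ length (filter (P? ∘ f) xs)
length-filter-map P? f []       = refl
length-filter-map P? f (x ∷ xs) with does (P? (f x))
... | true  = cong suc (length-filter-map P? f xs)
... | false = length-filter-map P? f xs

count : List ℕ → ℕ → ℕ
count W n = length (partitions W n)

countWhere : {P : List ℕ → Set} → Decidable P → List ℕ → ℕ → ℕ
countWhere P? W n = length (filter P? (partitions W n))

infixl 7 _onlyIf_

_onlyIf_ : ∀ {A B : Set} → List A → Dec B → List A
xs onlyIf yes _ = xs
xs onlyIf no _  = []

mutual
  partitions-∷ : ∀ p ps n → partitions (p ∷ ps) n ≡
    concatMap (λ k → map (k ∷_) (partitions ps (n ∸ k * p)) onlyIf (k * p ≤? n)) (upTo (suc n))
  partitions-∷ p ps n = List.concatMap-cong (partitions-∷-term p ps n) (upTo (suc n))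

  -- The left-hand side is the local helper of `partitions` for multiplicity k, which cannot be
  -- named outside Defs; its type is fixed by the use in partitions-∷.
  partitions-∷-term : ∀ p ps n k →
    _ ≡ (map (k ∷_) (partitions ps (n ∸ k * p)) onlyIf (k * p ≤? n))
  partitions-∷-term p ps n k with k * p ≤? n
  ... | yes _ = refl
  ... | no _  = refl

length-filter-onlyIf : ∀ {A B : Set} {P : A → Set} (P? : Decidable P) xs (d : Dec B) →
  length (filter P? (xs onlyIf d)) ≡ length (filter P? xs) when d
length-filter-onlyIf P? xs (yes _) = refl
length-filter-onlyIf P? xs (no _)  = refl

countWhere-∷ : ∀ {P : List ℕ → Set} (P? : Decidable P) p ps n →
  countWhere P? (p ∷ ps) n ≡ splitSum p (λ k → countWhere (P? ∘ (k ∷_)) ps) n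
countWhere-∷ P? p ps n = begin-equality
    length (filter P? (partitions (p ∷ ps) n))
  ≡⟨ cong (length ∘ filter P?) (partitions-∷ p ps n) ⟩
    length (filter P? (concatMap multiplicity (upTo (suc n))))
  ≡⟨ length-filter-concatMap P? multiplicity (upTo (suc n)) ⟩
    sum (map (length ∘ filter P? ∘ multiplicity) (upTo (suc n)))
  ≡⟨ cong sum (List.map-cong count-multiplicity (upTo (suc n))) ⟩
    sum (map (splitTerm p (λ k → countWhere (P? ∘ (k ∷_)) ps) n) (upTo (suc n)))
  ≡⟨ sum-map-applyUpTo _ (λ k → k) (suc n) ⟩
    splitSum p (λ k → countWhere (P? ∘ (k ∷_)) ps) n ∎
  where
  multiplicity : ℕ → List (List ℕ)
  multiplicity k = map (k ∷_) (partitions ps (n ∸ k * p)) onlyIf (k * p ≤? n)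
  count-multiplicity : ∀ k →
    length (filter P? (multiplicity k)) ≡ countWhere (P? ∘ (k ∷_)) ps (n ∸ k * p) when (k * p ≤? n)
  count-multiplicity k = ≡-trans (length-filter-onlyIf P? _ (k * p ≤? n))
    (cong (_when (k * p ≤? n)) (length-filter-map P? (k ∷_) (partitions ps (n ∸ k * p))))

countWhere-const : ∀ {A : Set} (d : Dec A) W n → countWhere (λ _ → d) W n ≡ count W n when d
countWhere-const (yes a)  W n =
  cong length (List.filter-all (λ _ → yes a) (All.universal (λ _ → a) (partitions W n)))
countWhere-const (no ¬a) W n =
  cong length (List.filter-none (λ _ → no ¬a) (All.universal (λ _ → ¬a) (partitions W n)))

countWhere-≐ : ∀ {P Q : List ℕ → Set} (P? : Decidable P) (Q? : Decidable Q) → P ≐ Q → ∀ W n →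
  countWhere P? W n ≡ countWhere Q? W n
countWhere-≐ P? Q? P≐Q W n = cong length (List.filter-≐ P? Q? P≐Q (partitions W n))

count-∷ : ∀ p ps n → count (p ∷ ps) n ≡ splitSum p (λ _ → count ps) n
count-∷ p ps n = begin-equality
  count (p ∷ ps) n                                     ≡⟨ countWhere-const (yes tt) (p ∷ ps) n ⟨
  countWhere (λ _ → yes tt) (p ∷ ps) n                 ≡⟨ countWhere-∷ (λ _ → yes tt) p ps n ⟩
  splitSum p (λ _ → countWhere (λ _ → yes tt) ps) n    ≡⟨ splitSum-cong p n (λ _ → countWhere-const (yes tt) ps) ⟩
  splitSum p (λ _ → count ps) n                        ∎

count-↭ : ∀ {W W′} → W ↭ W′ → All (1 ≤_) W → ∀ n → count W n ≡ count W′ n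
count-↭ refl                 _                 n = refl
count-↭ (prep {W} {W′} p W↭W′) (_ ∷ W≥1) n = begin-equality
  count (p ∷ W) n                  ≡⟨ count-∷ p W n ⟩
  splitSum p (λ _ → count W) n     ≡⟨ splitSum-cong p n (λ _ → count-↭ W↭W′ W≥1) ⟩
  splitSum p (λ _ → count W′) n    ≡⟨ count-∷ p W′ n ⟨
  count (p ∷ W′) n                 ∎
count-↭ (swap {W} {W′} p q W↭W′) (p≥1 ∷ q≥1 ∷ W≥1) n = begin-equality
  count (p ∷ q ∷ W) n                                           ≡⟨ count-∷ p (q ∷ W) n ⟩
  splitSum p (λ _ → count (q ∷ W)) n                            ≡⟨ splitSum-cong p n (λ _ → count-∷ q W) ⟩
  splitSum p (λ _ → splitSum q (λ _ → count W)) n               ≡⟨ splitSum-comm p≥1 q≥1 (λ _ _ → count W) n ⟩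
  splitSum q (λ _ → splitSum p (λ _ → count W)) n
    ≡⟨ splitSum-cong q n (λ _ r → splitSum-cong p r (λ _ → count-↭ W↭W′ W≥1)) ⟩
  splitSum q (λ _ → splitSum p (λ _ → count W′)) n              ≡⟨ splitSum-cong q n (λ _ → count-∷ p W′) ⟨
  splitSum q (λ _ → count (p ∷ W′)) n                           ≡⟨ count-∷ q (p ∷ W′) n ⟨
  count (q ∷ p ∷ W′) n                                          ∎
count-↭ (trans W↭W′ W′↭W″)   W≥1               n =
  ≡-trans (count-↭ W↭W′ W≥1 n) (count-↭ W′↭W″ (All-resp-↭ W↭W′ W≥1) n)

-- Partitions with more ones than parts from S

+-<⇒<∸ : ∀ j {x c} → j + x < c → x < c ∸ j
+-<⇒<∸ j {x} {c} j+x<c = m+n≤o⇒m≤o∸n (suc x) (subst (_≤ c) (cong suc (+-comm j x)) j+x<c)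

<∸⇒+-< : ∀ j {x c} → x < c ∸ j → j + x < c
<∸⇒+-< j {x} {c} x<c∸j = subst (_≤ c) (cong suc (+-comm x j)) (m≤o∸n⇒m+n≤o (suc x) j≤c x<c∸j)
  where
  j≤c : j ≤ c
  j≤c = <⇒≤ (m∸n≢0⇒n<m (λ c∸j≡0 → n≮0 (subst (x <_) c∸j≡0 x<c∸j)))

module _ (I : List ℕ) where

  fewer : List ℕ → ℕ → ℕ → ℕ
  fewer S c r = countWhere (λ m → sum (take (length S) m) <? c) (S ++ I) r

  fewer-[] : ∀ c r → fewer [] c r ≡ count I r when (0 <? c)
  fewer-[] c r = countWhere-const (0 <? c) I r

  fewer-∷ : ∀ s S c r → fewer (s ∷ S) c r ≡ splitSum s (λ j → fewer S (c ∸ j)) r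
  fewer-∷ s S c r = ≡-trans (countWhere-∷ _ s (S ++ I) r) (splitSum-cong s r λ j →
    countWhere-≐ (λ m → j + sum (take (length S) m) <? c) (λ m → sum (take (length S) m) <? c ∸ j)
      (+-<⇒<∸ j , <∸⇒+-< j) (S ++ I))

  fewer-0 : ∀ S r → fewer S 0 r ≡ 0
  fewer-0 S r = cong length (List.filter-none _ (All.universal (λ _ → n≮0) (partitions (S ++ I) r)))

  pR>S,I-splitSum : ∀ S n → pR>S,I (1 ∷ []) S I n ≡ splitSum 1 (fewer S) n
  pR>S,I-splitSum S n = ≡-trans (countWhere-∷ _ 1 (S ++ I) n) (splitSum-cong 1 n λ k →
    countWhere-≐ (λ m → sum (take (length S) m) <? k + 0) (λ m → sum (take (length S) m) <? k)
      (subst (_ <_) (+-identityʳ k) , subst (_ <_) (sym (+-identityʳ k))) (S ++ I))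

  splitSum-fewer : ∀ S → All (1 ≤_) S → ∀ n →
    splitSum 1 (fewer S) n ≡ count (map suc S ++ 1 ∷ I) (n ∸ 1) when (1 ≤? n)
  splitSum-fewer [] _ n = begin-equality
      splitSum 1 (fewer []) n
    ≡⟨ splitSum-cong 1 n fewer-[] ⟩
      splitSum 1 (λ c r → count I r when (0 <? c)) n
    ≡⟨ splitSum-peel ≤-refl (λ c r → count I r when (0 <? c)) n ⟩
      count I n when (0 <? 0) + splitSum 1 (λ c r → count I r when (0 <? suc c)) (n ∸ 1) when (1 ≤? n)
    ≡⟨ cong (_when (1 ≤? n)) (splitSum-cong 1 {h = λ _ → count I} (n ∸ 1) (λ c r → when-yes (0 <? suc c) z<s)) ⟩
      splitSum 1 (λ _ → count I) (n ∸ 1) when (1 ≤? n)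
    ≡⟨ cong (_when (1 ≤? n)) (count-∷ 1 I (n ∸ 1)) ⟨
      count (1 ∷ I) (n ∸ 1) when (1 ≤? n) ∎
  -- Exchange the sums over the multiplicities c of 1 and j of s, then let j of the c ones join
  -- the j copies of s.
  splitSum-fewer (s ∷ S) (s≥1 ∷ S≥1) n = begin-equality
      splitSum 1 (fewer (s ∷ S)) n
    ≡⟨ splitSum-cong 1 n (fewer-∷ s S) ⟩
      splitSum 1 (λ c → splitSum s (λ j → fewer S (c ∸ j))) n
    ≡⟨ splitSum-comm ≤-refl s≥1 (λ c j → fewer S (c ∸ j)) n ⟩
      splitSum s (λ j → splitSum 1 (λ c → fewer S (c ∸ j))) n
    ≡⟨ splitSum-cong s n (λ j → splitSum-shift ≤-refl (fewer S) (fewer-0 S) j) ⟩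
      splitSum s (λ j r → splitSum 1 (fewer S) (r ∸ j * 1) when (j * 1 ≤? r)) n
    ≡⟨ splitSum-cong s n (λ j r → cong (_when (j * 1 ≤? r)) (splitSum-fewer S S≥1 (r ∸ j * 1))) ⟩
      splitSum s (λ j r → count L (r ∸ j * 1 ∸ 1) when (1 ≤? r ∸ j * 1) when (j * 1 ≤? r)) n
    ≡⟨ sum-cong-≗ {suc n} (λ j → regroup (toℕ j)) ⟩
      ∑[ j ≤ n ] (splitTerm (suc s) (λ _ → count L) (n ∸ 1) (toℕ j) when (1 ≤? n))
    ≡⟨ ∑-when (suc n) (λ j → splitTerm (suc s) (λ _ → count L) (n ∸ 1) (toℕ j)) (1 ≤? n) ⟩
      (∑[ j ≤ n ] splitTerm (suc s) (λ _ → count L) (n ∸ 1) (toℕ j)) when (1 ≤? n)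
    ≡⟨ cong (_when (1 ≤? n)) (splitSum-range (s≤s z≤n) (λ _ → count L) (s≤s (m∸n≤m n 1))) ⟩
      splitSum (suc s) (λ _ → count L) (n ∸ 1) when (1 ≤? n)
    ≡⟨ cong (_when (1 ≤? n)) (count-∷ (suc s) L (n ∸ 1)) ⟨
      count (suc s ∷ L) (n ∸ 1) when (1 ≤? n) ∎
    where
    L : List ℕ
    L = map suc S ++ 1 ∷ I
    regroup : ∀ j →
      count L (n ∸ j * s ∸ j * 1 ∸ 1) when (1 ≤? n ∸ j * s ∸ j * 1) when (j * 1 ≤? n ∸ j * s) when (j * s ≤? n)
        ≡ count L (n ∸ 1 ∸ j * suc s) when (j * suc s ≤? n ∸ 1) when (1 ≤? n)
    regroup j = ≡-trans (when-nested-1 (j * s) (j * 1) n (count L))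
      (cong (λ m → count L (n ∸ 1 ∸ m) when (m ≤? n ∸ 1) when (1 ≤? n)) (distrib j s))
      where
      distrib : ∀ j s → j * s + j * 1 ≡ j * suc s
      distrib = solve-∀

  pR>S,I-suc : ∀ S → All (1 ≤_) S → ∀ n → pR>S,I (1 ∷ []) S I (suc n) ≡ count (map suc S ++ 1 ∷ I) n
  pR>S,I-suc S S≥1 n = ≡-trans (pR>S,I-splitSum S (suc n)) (splitSum-fewer S S≥1 (suc n))

-- Polynomial bounds on partition counts

count-[1] : ∀ n → count (1 ∷ []) n ≡ 1
count-[1] zero    = refl
count-[1] (suc n) = begin-equality
  count (1 ∷ []) (suc n)                   ≡⟨ count-∷ 1 [] (suc n) ⟩
  splitSum 1 (λ _ → count []) (suc n)      ≡⟨ splitSum-peel-≤ ≤-refl (λ _ → count []) {suc n} (s≤s z≤n) ⟩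
  splitSum 1 (λ _ → count []) n            ≡⟨ count-∷ 1 [] n ⟨
  count (1 ∷ []) n                         ≡⟨ count-[1] n ⟩
  1                                        ∎

binomial-≤ : ∀ d b e → (b + e) ^ suc d ≤ b ^ suc d + suc d * e * (b + e) ^ d
binomial-≤ zero    b e = ≤-reflexive (linear b e)
  where
  linear : ∀ b e → (b + e) * 1 ≡ b * 1 + 1 * e * 1
  linear = solve-∀
binomial-≤ (suc d) b e = begin
    (b + e) * (b + e) ^ suc d
  ≤⟨ *-monoʳ-≤ (b + e) (binomial-≤ d b e) ⟩
    (b + e) * (b ^ suc d + suc d * e * (b + e) ^ d)
  ≡⟨ distribute b e (b ^ suc d) d ((b + e) ^ d) ⟩
    b * b ^ suc d + e * b ^ suc d + suc d * e * ((b + e) * (b + e) ^ d)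
  ≤⟨ +-monoˡ-≤ _ (+-monoʳ-≤ (b * b ^ suc d) (*-monoʳ-≤ e (^-monoˡ-≤ (suc d) (m≤m+n b e)))) ⟩
    b * b ^ suc d + e * (b + e) ^ suc d + suc d * e * (b + e) ^ suc d
  ≡⟨ collect (b * b ^ suc d) e ((b + e) ^ suc d) d ⟩
    b ^ suc (suc d) + suc (suc d) * e * (b + e) ^ suc d ∎
  where
  distribute : ∀ b e X d Y → (b + e) * (X + suc d * e * Y) ≡ b * X + e * X + suc d * e * ((b + e) * Y)
  distribute = solve-∀
  collect : ∀ X e Z d → X + e * Z + suc d * e * Z ≡ X + suc (suc d) * e * Z
  collect = solve-∀

binomial-≥ : ∀ d x w → x ^ suc d + suc d * w * x ^ d ≤ (x + w) ^ suc d
binomial-≥ zero    x w = ≤-reflexive (linear x w)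
  where
  linear : ∀ x w → x * 1 + 1 * w * 1 ≡ (x + w) * 1
  linear = solve-∀
binomial-≥ (suc d) x w = begin
    x * (x * x ^ d) + suc (suc d) * w * (x * x ^ d)
  ≤⟨ m≤m+n _ (suc d * w * w * x ^ d) ⟩
    x * (x * x ^ d) + suc (suc d) * w * (x * x ^ d) + suc d * w * w * x ^ d
  ≡⟨ factor x w (x ^ d) d ⟩
    (x + w) * (x * x ^ d + suc d * w * x ^ d)
  ≤⟨ *-monoʳ-≤ (x + w) (binomial-≥ d x w) ⟩
    (x + w) * (x + w) ^ suc d ∎
  where
  factor : ∀ x w P d → x * (x * P) + suc (suc d) * w * (x * P) + suc d * w * w * P ≡ (x + w) * (x * P + suc d * w * P)
  factor = solve-∀

[m+n]^o≤2^o*m^o : ∀ e {n C} → C ≤ n → (n + C) ^ e ≤ 2 ^ e * n ^ e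
[m+n]^o≤2^o*m^o zero    C≤n = ≤-refl
[m+n]^o≤2^o*m^o (suc e) {n} {C} C≤n = begin
  (n + C) * (n + C) ^ e       ≤⟨ *-mono-≤ (+-monoʳ-≤ n C≤n) ([m+n]^o≤2^o*m^o e C≤n) ⟩
  (n + n) * (2 ^ e * n ^ e)   ≡⟨ regroup n (2 ^ e) (n ^ e) ⟩
  2 * 2 ^ e * (n * n ^ e)     ∎
  where
  regroup : ∀ n X Y → (n + n) * (X * Y) ≡ 2 * X * (n * Y)
  regroup = solve-∀

^-gap : ∀ d m C → C ≤ suc m → suc m * ((suc m + C) ^ d ∸ m ^ d) ≤ d * suc C * 2 ^ d * suc m ^ d
^-gap zero    m C _   = ≤-reflexive (*-zeroʳ (suc m))
^-gap (suc e) m C C≤n = begin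
    n * ((n + C) ^ suc e ∸ m ^ suc e)
  ≤⟨ *-monoʳ-≤ n (m≤n+o⇒m∸n≤o _ (m ^ suc e) (subst (λ x → x ^ suc e ≤ m ^ suc e + suc e * suc C * x ^ e)
       (+-suc m C) (binomial-≤ e m (suc C)))) ⟩
    n * (suc e * suc C * (n + C) ^ e)
  ≡⟨ swap-n n (suc e * suc C) ((n + C) ^ e) ⟩
    suc e * suc C * (n * (n + C) ^ e)
  ≤⟨ *-monoʳ-≤ (suc e * suc C) (*-monoʳ-≤ n ([m+n]^o≤2^o*m^o e C≤n)) ⟩
    suc e * suc C * (n * (2 ^ e * n ^ e))
  ≡⟨ swap-n′ (suc e * suc C) n (2 ^ e) (n ^ e) ⟩
    suc e * suc C * 2 ^ e * n ^ suc e
  ≤⟨ *-monoˡ-≤ (n ^ suc e) (*-monoʳ-≤ (suc e * suc C) (m≤m*n (2 ^ e) 2)) ⟩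
    suc e * suc C * (2 ^ e * 2) * n ^ suc e
  ≡⟨ cong (λ x → suc e * suc C * x * n ^ suc e) (*-comm (2 ^ e) 2) ⟩
    suc e * suc C * 2 ^ suc e * n ^ suc e ∎
  where
  n = suc m
  swap-n : ∀ n K Z → n * (K * Z) ≡ K * (n * Z)
  swap-n = solve-∀
  swap-n′ : ∀ K n X Y → K * (n * (X * Y)) ≡ K * X * (n * Y)
  swap-n′ = solve-∀

count-∷-≤ : ∀ {p} → 1 ≤ p → ∀ ps {n} → p ≤ n → count (p ∷ ps) n ≡ count ps n + count (p ∷ ps) (n ∸ p)
count-∷-≤ {p} p≥1 ps {n} p≤n = begin-equality
  count (p ∷ ps) n                                      ≡⟨ count-∷ p ps n ⟩
  splitSum p (λ _ → count ps) n                         ≡⟨ splitSum-peel-≤ p≥1 (λ _ → count ps) p≤n ⟩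
  count ps n + splitSum p (λ _ → count ps) (n ∸ p)      ≡⟨ cong (_+_ (count ps n)) (count-∷ p ps (n ∸ p)) ⟨
  count ps n + count (p ∷ ps) (n ∸ p)                   ∎

count-∷-< : ∀ {p} → 1 ≤ p → ∀ ps {n} → n < p → count (p ∷ ps) n ≡ count ps n
count-∷-< {p} p≥1 ps {n} n<p = ≡-trans (count-∷ p ps n) (splitSum-peel-< p≥1 (λ _ → count ps) n<p)

-- count (W ∷ʳ 1) n counts the lattice points x ≥ 0 with Σ w x_w ≤ n, a simplex of volume n ^ d / κ W.
κ : List ℕ → ℕ
κ W = length W ! * product W

κ-∷ : ∀ w W → κ (w ∷ W) ≡ suc (length W) * w * κ W
κ-∷ w W = reassoc (length W) (length W !) w (product W)
  where
  reassoc : ∀ d F w P → suc d * F * (w * P) ≡ suc d * w * (F * P)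
  reassoc = solve-∀

count-lowerBound : ∀ W → All (1 ≤_) W → ∀ n → n ^ length W ≤ κ W * count (W ∷ʳ 1) n
count-lowerBound []      _            n = ≤-reflexive (sym (≡-trans (*-identityˡ _) (count-[1] n)))
count-lowerBound (w ∷ V) (w≥1 ∷ V≥1) n = subst (n ^ suc d ≤_) (cong (_* T n) (sym (κ-∷ w V))) (<-rec _ bound n)
  where
  d = length V
  g = count (V ∷ʳ 1)
  T = count (w ∷ V ∷ʳ 1)
  bound : ∀ n → (∀ {m} → m < n → m ^ suc d ≤ suc d * w * κ V * T m) → n ^ suc d ≤ suc d * w * κ V * T n
  bound n ih with w ≤? n
  ... | yes w≤n = begin
      n ^ suc d                                           ≡⟨ cong (_^ suc d) (m∸n+n≡m w≤n) ⟨
      (n ∸ w + w) ^ suc d                                 ≤⟨ binomial-≤ d (n ∸ w) w ⟩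
      (n ∸ w) ^ suc d + suc d * w * (n ∸ w + w) ^ d       ≡⟨ cong (λ x → (n ∸ w) ^ suc d + suc d * w * x ^ d) (m∸n+n≡m w≤n) ⟩
      (n ∸ w) ^ suc d + suc d * w * n ^ d
        ≤⟨ +-mono-≤ (ih (∸-monoʳ-< w≥1 w≤n)) (*-monoʳ-≤ (suc d * w) (count-lowerBound V V≥1 n)) ⟩
      suc d * w * κ V * T (n ∸ w) + suc d * w * (κ V * g n) ≡⟨ collect (suc d * w) (κ V) (T (n ∸ w)) (g n) ⟩
      suc d * w * κ V * (g n + T (n ∸ w))                 ≡⟨ cong (suc d * w * κ V *_) (count-∷-≤ w≥1 (V ∷ʳ 1) w≤n) ⟨
      suc d * w * κ V * T n                               ∎
    where
    collect : ∀ c K t x → c * K * t + c * (K * x) ≡ c * K * (x + t)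
    collect = solve-∀
  ... | no w≰n = begin
      n * n ^ d                   ≤⟨ *-mono-≤ (<⇒≤ (≰⇒> w≰n)) (count-lowerBound V V≥1 n) ⟩
      w * (κ V * g n)             ≤⟨ m≤m+n _ (d * (w * (κ V * g n))) ⟩
      suc d * (w * (κ V * g n))   ≡⟨ reassoc (suc d) w (κ V) (g n) ⟩
      suc d * w * κ V * g n       ≡⟨ cong (suc d * w * κ V *_) (count-∷-< w≥1 (V ∷ʳ 1) (≰⇒> w≰n)) ⟨
      suc d * w * κ V * T n       ∎
    where
    reassoc : ∀ s w K x → s * (w * (K * x)) ≡ s * w * K * x
    reassoc = solve-∀

count-upperBound : ∀ W → All (1 ≤_) W → ∀ n → κ W * count (W ∷ʳ 1) n ≤ (n + sum W) ^ length W
count-upperBound []      _            n = ≤-reflexive (≡-trans (*-identityˡ _) (count-[1] n))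
count-upperBound (w ∷ V) (w≥1 ∷ V≥1) n =
  subst (_≤ (n + (w + c)) ^ suc d) (cong (_* T n) (sym (κ-∷ w V))) (<-rec _ bound n)
  where
  d = length V
  c = sum V
  g = count (V ∷ʳ 1)
  T = count (w ∷ V ∷ʳ 1)
  close : ∀ n → (n + c) ^ suc d + suc d * w * (n + c) ^ d ≤ (n + (w + c)) ^ suc d
  close n = begin
    (n + c) ^ suc d + suc d * w * (n + c) ^ d   ≤⟨ binomial-≥ d (n + c) w ⟩
    (n + c + w) ^ suc d                         ≡⟨ cong (_^ suc d) (≡-trans (+-assoc n c w) (cong (_+_ n) (+-comm c w))) ⟩
    (n + (w + c)) ^ suc d                       ∎
  bound : ∀ n → (∀ {m} → m < n → suc d * w * κ V * T m ≤ (m + (w + c)) ^ suc d) →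
    suc d * w * κ V * T n ≤ (n + (w + c)) ^ suc d
  bound n ih with w ≤? n
  ... | yes w≤n = begin
      suc d * w * κ V * T n                               ≡⟨ cong (suc d * w * κ V *_) (count-∷-≤ w≥1 (V ∷ʳ 1) w≤n) ⟩
      suc d * w * κ V * (g n + T (n ∸ w))                 ≡⟨ distribute (suc d * w) (κ V) (g n) (T (n ∸ w)) ⟩
      suc d * w * (κ V * g n) + suc d * w * κ V * T (n ∸ w)
        ≤⟨ +-mono-≤ (*-monoʳ-≤ (suc d * w) (count-upperBound V V≥1 n)) (ih (∸-monoʳ-< w≥1 w≤n)) ⟩
      suc d * w * (n + c) ^ d + (n ∸ w + (w + c)) ^ suc d ≡⟨ cong (λ x → suc d * w * (n + c) ^ d + x ^ suc d) n∸w+w+c≡n+c ⟩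
      suc d * w * (n + c) ^ d + (n + c) ^ suc d           ≡⟨ +-comm _ ((n + c) ^ suc d) ⟩
      (n + c) ^ suc d + suc d * w * (n + c) ^ d           ≤⟨ close n ⟩
      (n + (w + c)) ^ suc d                               ∎
    where
    distribute : ∀ s K x t → s * K * (x + t) ≡ s * (K * x) + s * K * t
    distribute = solve-∀
    n∸w+w+c≡n+c : n ∸ w + (w + c) ≡ n + c
    n∸w+w+c≡n+c = ≡-trans (sym (+-assoc (n ∸ w) w c)) (cong (_+ c) (m∸n+n≡m w≤n))
  ... | no w≰n = begin
      suc d * w * κ V * T n                        ≡⟨ cong (suc d * w * κ V *_) (count-∷-< w≥1 (V ∷ʳ 1) (≰⇒> w≰n)) ⟩
      suc d * w * κ V * g n                        ≡⟨ *-assoc (suc d * w) (κ V) (g n) ⟩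
      suc d * w * (κ V * g n)                      ≤⟨ *-monoʳ-≤ (suc d * w) (count-upperBound V V≥1 n) ⟩
      suc d * w * (n + c) ^ d                      ≤⟨ m≤n+m _ ((n + c) ^ suc d) ⟩
      (n + c) ^ suc d + suc d * w * (n + c) ^ d    ≤⟨ close n ⟩
      (n + (w + c)) ^ suc d                        ∎

-- The limit

∣-∣≤∸ : ∀ {lo hi x y} → lo ≤ x → x ≤ hi → lo ≤ y → y ≤ hi → ∣ x - y ∣ ≤ hi ∸ lo
∣-∣≤∸ {lo} {hi} {x} {y} lo≤x x≤hi lo≤y y≤hi with ≤-total x y
... | inj₁ x≤y = subst (_≤ hi ∸ lo) (sym (m≤n⇒∣m-n∣≡n∸m x≤y)) (∸-mono y≤hi lo≤x)
... | inj₂ y≤x = subst (_≤ hi ∸ lo) (sym (m≤n⇒∣n-m∣≡n∸m y≤x)) (∸-mono x≤hi lo≤y)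

1≤*⇒1≤ : ∀ {a b} → 1 ≤ a * b → 1 ≤ a
1≤*⇒1≤ {suc a} _ = s≤s z≤n

∣⊖∣≡∣-∣ : ∀ m n → ℤ.∣ m ⊖ n ∣ ≡ ∣ m - n ∣
∣⊖∣≡∣-∣ m n with ≤-total m n
... | inj₁ m≤n = ≡-trans (ℤ.∣⊖∣-≤ m≤n) (sym (m≤n⇒∣m-n∣≡n∸m m≤n))
... | inj₂ n≤m = ≡-trans (ℤ.∣m⊖n∣≡∣n⊖m∣ m n) (≡-trans (ℤ.∣⊖∣-≤ n≤m) (sym (m≤n⇒∣n-m∣≡n∸m n≤m)))

∣/-/∣<mkℚ : ∀ a b c d {e f} .(cop : Coprime (suc e) (suc f)) →
  suc f * ∣ a * suc d - c * suc b ∣ < suc b * suc d →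
  ℚ.∣ (+ a) / suc b ℚ.- (+ c) / suc d ∣ ℚ.< mkℚ +[1+ e ] f cop
∣/-/∣<mkℚ a b c d {e} {f} cop f∣ad-cb∣<bd =
  ℚ.toℚᵘ-cancel-< (ℚᵘ.<-respˡ-≃ (ℚᵘ.≃-sym toℚᵘ-∣x-y∣) (*<* cross-multiplied))
  where
  x y : ℚ
  x = (+ a) / suc b
  y = (+ c) / suc d
  xᵘ yᵘ : ℚᵘ.ℚᵘ
  xᵘ = mkℚᵘ (+ a) b
  yᵘ = mkℚᵘ (+ c) d
  toℚᵘ-∣x-y∣ : ℚ.toℚᵘ ℚ.∣ x ℚ.- y ∣ ℚᵘ.≃ ℚᵘ.∣ xᵘ ℚᵘ.- yᵘ ∣
  toℚᵘ-∣x-y∣ = ℚᵘ.≃-trans (ℚ.toℚᵘ-homo-∣-∣ (x ℚ.- y)) (ℚᵘ.∣-∣-cong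
    (ℚᵘ.≃-trans (ℚ.toℚᵘ-homo-+ x (ℚ.- y))
    (ℚᵘ.+-cong (ℚ.toℚᵘ-fromℚᵘ xᵘ) (ℚᵘ.≃-trans (ℚ.toℚᵘ-homo‿- y) (ℚᵘ.-‿cong (ℚ.toℚᵘ-fromℚᵘ yᵘ))))))
  numerator : (+ a) ℤ.* (+ suc d) ℤ.+ (ℤ.- (+ c)) ℤ.* (+ suc b) ≡ (a * suc d) ⊖ (c * suc b)
  numerator = ≡-trans (cong₂ ℤ._+_ (sym (ℤ.pos-* a (suc d)))
      (≡-trans (sym (ℤ.neg-distribˡ-* (+ c) (+ suc b))) (cong ℤ.-_ (sym (ℤ.pos-* c (suc b))))))
    (ℤ.m-n≡m⊖n (a * suc d) (c * suc b))
  D = ∣ a * suc d - c * suc b ∣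
  B = suc b * suc d
  cross-multiplied : + ℤ.∣ (+ a) ℤ.* (+ suc d) ℤ.+ (ℤ.- (+ c)) ℤ.* (+ suc b) ∣ ℤ.* + suc f ℤ.< +[1+ e ] ℤ.* + B
  cross-multiplied = subst₂ ℤ._<_
    (≡-trans (ℤ.pos-* D (suc f))
      (cong (λ z → + z ℤ.* + suc f) (sym (≡-trans (cong ℤ.∣_∣ numerator) (∣⊖∣≡∣-∣ (a * suc d) (c * suc b))))))
    (ℤ.pos-* (suc e) B)
    (ℤ.+<+ (<-≤-trans (subst (_< B) (*-comm (suc f) D) f∣ad-cb∣<bd) (m≤m+n B (e * B))))

ratio-close : ∀ a b u v {e f} .(cop : Coprime (suc e) (suc f)) →
  suc f * ∣ a * suc v - u * b ∣ < b * suc v → ℚ.∣ ratio a b ℚ.- (+ u) / suc v ∣ ℚ.< mkℚ +[1+ e ] f cop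
ratio-close a (suc b) u v cop close = ∣/-/∣<mkℚ a b u v cop close

-- If κ A n and κ′ Q n both lie between (n - 1) ^ d and (n + C) ^ d, their difference is O(n ^ (d - 1)),
-- so Q n / A n tends to κ / κ′ = u / v.
module RatioLimit {d C κ κ′ u v′ : ℕ} (κ′u≡κv : κ′ * u ≡ κ * suc v′) (A Q : ℕ → ℕ)
  (A-lower : ∀ n → n ^ d ≤ κ * A n) (A-upper : ∀ n → κ * A n ≤ (n + C) ^ d)
  (Q-lower : ∀ m → m ^ d ≤ κ′ * Q (suc m)) (Q-upper : ∀ m → κ′ * Q (suc m) ≤ (suc m + C) ^ d) where

  private
    v K : ℕ
    v = suc v′
    K = d * suc C * 2 ^ d

  κ′≥1 : 1 ≤ κ′
  κ′≥1 = 1≤*⇒1≤ (subst (_≤ κ′ * Q 2) (^-zeroˡ d) (Q-lower 1))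

  gap : ∀ m → C ≤ suc m → suc m * ∣ κ′ * Q (suc m) - κ * A (suc m) ∣ ≤ K * (κ * A (suc m))
  gap m C≤n = begin
      n * ∣ κ′ * Q n - κ * A n ∣      ≤⟨ *-monoʳ-≤ n (∣-∣≤∸ (Q-lower m) (Q-upper m) A-lower′ (A-upper n)) ⟩
      n * ((n + C) ^ d ∸ m ^ d)      ≤⟨ ^-gap d m C C≤n ⟩
      K * n ^ d                      ≤⟨ *-monoʳ-≤ K (A-lower n) ⟩
      K * (κ * A n)                  ∎
    where
    n = suc m
    A-lower′ : m ^ d ≤ κ * A n
    A-lower′ = ≤-trans (^-monoˡ-≤ d (n≤1+n m)) (A-lower n)

  cross-multiply : ∀ n → κ * κ′ * ∣ Q n * v - u * A n ∣ ≡ κ * v * ∣ κ′ * Q n - κ * A n ∣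
  cross-multiply n = begin-equality
    κ * κ′ * ∣ Q n * v - u * A n ∣                    ≡⟨ *-distribˡ-∣-∣ (κ * κ′) (Q n * v) (u * A n) ⟩
    ∣ κ * κ′ * (Q n * v) - κ * κ′ * (u * A n) ∣       ≡⟨ cong₂ ∣_-_∣ (regroupQ κ κ′ (Q n) v) (regroupA κ κ′ u (A n)) ⟩
    ∣ κ * v * (κ′ * Q n) - κ * (κ′ * u) * A n ∣       ≡⟨ cong (λ x → ∣ κ * v * (κ′ * Q n) - κ * x * A n ∣) κ′u≡κv ⟩
    ∣ κ * v * (κ′ * Q n) - κ * (κ * v) * A n ∣       ≡⟨ cong (∣ κ * v * (κ′ * Q n) -_∣) (regroupκ κ v (A n)) ⟩
    ∣ κ * v * (κ′ * Q n) - κ * v * (κ * A n) ∣       ≡⟨ *-distribˡ-∣-∣ (κ * v) (κ′ * Q n) (κ * A n) ⟨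
    κ * v * ∣ κ′ * Q n - κ * A n ∣                    ∎
    where
    regroupQ : ∀ κ κ′ q v → κ * κ′ * (q * v) ≡ κ * v * (κ′ * q)
    regroupQ = solve-∀
    regroupA : ∀ κ κ′ u a → κ * κ′ * (u * a) ≡ κ * (κ′ * u) * a
    regroupA = solve-∀
    regroupκ : ∀ κ v a → κ * (κ * v) * a ≡ κ * v * (κ * a)
    regroupκ = solve-∀

  eventually-close : ∀ q → ∃ λ N → ∀ n → N ≤ n → q * ∣ Q n * v - u * A n ∣ < A n * v
  eventually-close q = suc (C + q * κ * K) , close
    where
    close : ∀ n → suc (C + q * κ * K) ≤ n → q * ∣ Q n * v - u * A n ∣ < A n * v
    close (suc m) (s≤s N≤m) = *-cancelˡ-< (κ * κ′ * n) _ _ (begin-strict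
        κ * κ′ * n * (q * D)         ≡⟨ regroup₁ κ κ′ n q D ⟩
        n * q * (κ * κ′ * D)         ≡⟨ cong (n * q *_) (cross-multiply n) ⟩
        n * q * (κ * v * G)          ≡⟨ regroup₂ n q κ v G ⟩
        v * (q * κ * (n * G))        ≤⟨ *-monoʳ-≤ v (*-monoʳ-≤ (q * κ) (gap m C≤n)) ⟩
        v * (q * κ * (K * X))        ≡⟨ cong (v *_) (*-assoc (q * κ) K X) ⟨
        v * (q * κ * K * X)          <⟨ *-monoʳ-< v (*-monoˡ-< X {{>-nonZero X≥1}} qκK<nκ′) ⟩
        v * (n * κ′ * X)             ≡⟨ regroup₃ v n κ′ κ (A n) ⟩
        κ * κ′ * n * (A n * v)       ∎)
      where
      n = suc m
      D = ∣ Q n * v - u * A n ∣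
      G = ∣ κ′ * Q n - κ * A n ∣
      X = κ * A n
      C≤n : C ≤ n
      C≤n = ≤-trans (m≤m+n C (q * κ * K)) (m≤n⇒m≤1+n N≤m)
      X≥1 : 1 ≤ X
      X≥1 = ≤-trans (subst (_≤ n ^ d) (^-zeroˡ d) (^-monoˡ-≤ d (s≤s z≤n))) (A-lower n)
      qκK<nκ′ : q * κ * K < n * κ′
      qκK<nκ′ = <-≤-trans (s≤s (≤-trans (m≤n+m (q * κ * K) C) N≤m)) (m≤m*n n κ′ {{>-nonZero κ′≥1}})
      regroup₁ : ∀ κ κ′ n q D → κ * κ′ * n * (q * D) ≡ n * q * (κ * κ′ * D)
      regroup₁ = solve-∀
      regroup₂ : ∀ n q κ v G → n * q * (κ * v * G) ≡ v * (q * κ * (n * G))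
      regroup₂ = solve-∀
      regroup₃ : ∀ v n κ′ κ a → v * (n * κ′ * (κ * a)) ≡ κ * κ′ * n * (a * v)
      regroup₃ = solve-∀

  Q/A⟶u/v : (λ n → ratio (Q n) (A n)) ⟶ ((+ u) / suc v′)
  Q/A⟶u/v (mkℚ +[1+ e ] f cop) _ =
    map₂ (λ close n N≤n → ratio-close (Q n) (A n) u v′ cop (close n N≤n)) (eventually-close (suc f))
  Q/A⟶u/v (mkℚ +0       _ _) 0<ε = ⊥-elim (ℤ.Positive.pos (ℚ.positive 0<ε))
  Q/A⟶u/v (mkℚ -[1+ _ ] _ _) 0<ε = ⊥-elim (ℤ.Positive.pos (ℚ.positive 0<ε))

length-map-suc-++ : ∀ S I → length (map suc S ++ I) ≡ length (S ++ I)
length-map-suc-++ S I = begin-equality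
  length (map suc S ++ I)         ≡⟨ List.length-++ (map suc S) ⟩
  length (map suc S) + length I   ≡⟨ cong (_+ length I) (List.length-map suc S) ⟩
  length S + length I             ≡⟨ List.length-++ S ⟨
  length (S ++ I)                 ∎

κ-map-suc : ∀ S I → κ (S ++ I) * product (map suc S) ≡ κ (map suc S ++ I) * product S
κ-map-suc S I = begin-equality
    length (S ++ I) ! * product (S ++ I) * product (map suc S)
  ≡⟨ cong (λ P → length (S ++ I) ! * P * product (map suc S)) (product-++ S I) ⟩
    length (S ++ I) ! * (product S * product I) * product (map suc S)
  ≡⟨ regroup (length (S ++ I) !) (product S) (product I) (product (map suc S)) ⟩
    length (S ++ I) ! * (product (map suc S) * product I) * product S
  ≡⟨ cong₂ (λ L P → L ! * P * product S) (length-map-suc-++ S I) (product-++ (map suc S) I) ⟨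
    length (map suc S ++ I) ! * product (map suc S ++ I) * product S ∎
  where
  regroup : ∀ F P Q P′ → F * (P * Q) * P′ ≡ F * (P′ * Q) * P
  regroup = solve-∀

product-map-suc≢0 : ∀ S → NonZero (product (map suc S))
product-map-suc≢0 []      = _
product-map-suc≢0 (s ∷ S) = m*n≢0 (suc s) (product (map suc S)) {{_}} {{product-map-suc≢0 S}}

module _ (S I : List ℕ) (S≥1 : All (1 ≤_) S) (I≥1 : All (1 ≤_) I) where

  private
    W W′ : List ℕ
    W  = S ++ I
    W′ = map suc S ++ I
    d = length W
    C = sum W + sum W′
    A Q : ℕ → ℕ
    A = pRSI (1 ∷ []) S I
    Q = pR>S,I (1 ∷ []) S I
    W≥1 : All (1 ≤_) W
    W≥1 = All.++⁺ S≥1 I≥1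
    S′≥1 : All (1 ≤_) (map suc S)
    S′≥1 = All.map⁺ (All.universal (λ _ → s≤s z≤n) S)
    W′≥1 : All (1 ≤_) W′
    W′≥1 = All.++⁺ S′≥1 I≥1

  A≡count : ∀ n → A n ≡ count (W ∷ʳ 1) n
  A≡count = count-↭ (∷↭∷ʳ 1 W) (≤-refl ∷ W≥1)

  Q≡count : ∀ m → Q (suc m) ≡ count (W′ ∷ʳ 1) m
  Q≡count m = ≡-trans (pR>S,I-suc I S S≥1 m)
    (count-↭ (trans (shift 1 (map suc S) I) (∷↭∷ʳ 1 W′)) (All.++⁺ S′≥1 (≤-refl ∷ I≥1)) m)

  A-lower : ∀ n → n ^ d ≤ κ W * A n
  A-lower n = subst (λ x → n ^ d ≤ κ W * x) (sym (A≡count n)) (count-lowerBound W W≥1 n)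

  A-upper : ∀ n → κ W * A n ≤ (n + C) ^ d
  A-upper n = subst (λ x → κ W * x ≤ (n + C) ^ d) (sym (A≡count n))
    (≤-trans (count-upperBound W W≥1 n) (^-monoˡ-≤ d (+-monoʳ-≤ n (m≤m+n (sum W) (sum W′)))))

  Q-lower : ∀ m → m ^ d ≤ κ W′ * Q (suc m)
  Q-lower m = subst₂ (λ e x → m ^ e ≤ κ W′ * x) (length-map-suc-++ S I) (sym (Q≡count m))
    (count-lowerBound W′ W′≥1 m)

  Q-upper : ∀ m → κ W′ * Q (suc m) ≤ (suc m + C) ^ d
  Q-upper m = subst₂ (λ e x → κ W′ * x ≤ (suc m + C) ^ e) (length-map-suc-++ S I) (sym (Q≡count m))
    (≤-trans (count-upperBound W′ W′≥1 m) (^-monoˡ-≤ (length W′) (+-mono-≤ (n≤1+n m) (m≤n+m (sum W′) (sum W)))))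

  ratio⟶ : ∀ u v .{{_ : NonZero v}} → u * product (map suc S) ≡ v * product S →
    (λ n → ratio (Q n) (A n)) ⟶ ((+ u) / v)
  ratio⟶ u v@(suc v′) uS′≡vS =
    RatioLimit.Q/A⟶u/v {d} {C} {κ W} {κ W′} {u} {v′} κ′u≡κv A Q A-lower A-upper Q-lower Q-upper
    where
    κ′u≡κv : κ W′ * u ≡ κ W * v
    κ′u≡κv = *-cancelʳ-≡ (κ W′ * u) (κ W * v) (product (map suc S)) {{product-map-suc≢0 S}} (begin-equality
      κ W′ * u * product (map suc S)     ≡⟨ *-assoc (κ W′) u _ ⟩
      κ W′ * (u * product (map suc S))   ≡⟨ cong (κ W′ *_) uS′≡vS ⟩
      κ W′ * (v * product S)             ≡⟨ swap-middle (κ W′) v (product S) ⟩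
      v * (κ W′ * product S)             ≡⟨ cong (v *_) (κ-map-suc S I) ⟨
      v * (κ W * product (map suc S))    ≡⟨ swap-middle v (κ W) _ ⟩
      κ W * (v * product (map suc S))    ≡⟨ *-assoc (κ W) v _ ⟨
      κ W * v * product (map suc S)      ∎)
      where
      swap-middle : ∀ a b c → a * (b * c) ≡ b * (a * c)
      swap-middle = solve-∀

-- The two product formulas

/-*-/ : ∀ a b c d .{{_ : NonZero b}} .{{_ : NonZero d}} →
  ((+ a) / b) ℚ.* ((+ c) / d) ≡ ((+ (a * c)) / (b * d)) {{m*n≢0 b d}}
/-*-/ a (suc b) c (suc d) = ℚ.toℚᵘ-injective
  (ℚᵘ.≃-trans (ℚ.toℚᵘ-homo-* ((+ a) / suc b) ((+ c) / suc d))
  (ℚᵘ.≃-trans (ℚᵘ.*-cong (ℚ.toℚᵘ-fromℚᵘ (mkℚᵘ (+ a) b)) (ℚ.toℚᵘ-fromℚᵘ (mkℚᵘ (+ c) d)))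
  (ℚᵘ.≃-trans (ℚᵘ.≃-reflexive (cong (λ z → mkℚᵘ z (d + b * suc d)) (sym (ℤ.pos-* a c))))
  (ℚᵘ.≃-sym (ℚ.toℚᵘ-fromℚᵘ (mkℚᵘ (+ (a * c)) (d + b * suc d)))))))

prodRatio-≡ : ∀ S → prodRatio S ≡ ((+ product S) / product (map suc S)) {{product-map-suc≢0 S}}
prodRatio-≡ []      = refl
prodRatio-≡ (s ∷ S) = ≡-trans (cong (((+ s) / suc s) ℚ.*_) (prodRatio-≡ S))
  (/-*-/ s (suc s) (product S) (product (map suc S)) {{_}} {{product-map-suc≢0 S}})

product-map-upTo-suc : ∀ (f : ℕ → ℕ) m → product (map f (upTo (suc m))) ≡ product (map f (upTo m)) * f m
product-map-upTo-suc f m = begin-equality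
  product (map f (upTo (suc m)))                 ≡⟨ cong (product ∘ map f) (List.upTo-∷ʳ m) ⟨
  product (map f (upTo m ++ m ∷ []))             ≡⟨ cong product (List.map-++ f (upTo m) (m ∷ [])) ⟩
  product (map f (upTo m) ++ f m ∷ [])           ≡⟨ product-++ (map f (upTo m)) (f m ∷ []) ⟩
  product (map f (upTo m)) * (f m * 1)           ≡⟨ cong (_*_ (product (map f (upTo m)))) (*-identityʳ (f m)) ⟩
  product (map f (upTo m)) * f m                 ∎

∏[i+3]-telescope : ∀ m → 2 * product (map (λ i → suc (i + 2)) (upTo m)) ≡ suc (suc m) * product (map (λ i → i + 2) (upTo m))
∏[i+3]-telescope zero    = refl
∏[i+3]-telescope (suc m) = begin-equality
    2 * product (map (λ i → suc (i + 2)) (upTo (suc m)))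
  ≡⟨ cong (2 *_) (product-map-upTo-suc (λ i → suc (i + 2)) m) ⟩
    2 * (P′ * suc (m + 2))
  ≡⟨ *-assoc 2 P′ (suc (m + 2)) ⟨
    2 * P′ * suc (m + 2)
  ≡⟨ cong₂ (λ x y → x * suc y) (∏[i+3]-telescope m) (+-comm m 2) ⟩
    suc (suc m) * P * suc (suc (suc m))
  ≡⟨ regroup (suc (suc m)) P ⟩
    suc (suc (suc m)) * (P * suc (suc m))
  ≡⟨ cong (λ x → suc (suc (suc m)) * (P * x)) (+-comm m 2) ⟨
    suc (suc (suc m)) * (P * (m + 2))
  ≡⟨ cong (suc (suc (suc m)) *_) (product-map-upTo-suc (λ i → i + 2) m) ⟨
    suc (suc (suc m)) * product (map (λ i → i + 2) (upTo (suc m))) ∎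
  where
  P P′ : ℕ
  P  = product (map (λ i → i + 2) (upTo m))
  P′ = product (map (λ i → suc (i + 2)) (upTo m))
  regroup : ∀ x P → x * P * suc x ≡ suc x * (P * x)
  regroup = solve-∀

twoTo-positive : ∀ k → All (1 ≤_) (twoTo k)
twoTo-positive k = All.map⁺ (All.universal (λ i → ≤-trans (s≤s z≤n) (m≤n+m 2 i)) (upTo (k ∸ 1)))

twoTo-ratio : ∀ {k} → 1 ≤ k → 2 * product (map suc (twoTo k)) ≡ suc k * product (twoTo k)
twoTo-ratio {suc m} _ = ≡-trans (cong ((2 *_) ∘ product) (sym (List.map-∘ (upTo m)))) (∏[i+3]-telescope m)

corollary2 :
    ((S I : List ℕ) → Unique S → All (λ s → 1 < s) S →
      Unique I → All (λ i → 1 ≤ i) I → All (λ i → i ∉ 1 ∷ S) I →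
      (λ n → ratio (pR>S,I (1 ∷ []) S I n) (pRSI (1 ∷ []) S I n)) ⟶ prodRatio S)
    ×
    ((k : ℕ) (I : List ℕ) → 2 ≤ k →
      Unique I → All (λ i → 1 ≤ i) I → All (λ i → i ∉ 1 ∷ twoTo k) I →
      (λ n → ratio (pR>S,I (1 ∷ []) (twoTo k) I n) (pRSI (1 ∷ []) (twoTo k) I n))
        ⟶ ((+ 2) / suc k))
corollary2 =
  (λ S I _ S>1 _ I≥1 _ → subst ((λ n → ratio (pR>S,I (1 ∷ []) S I n) (pRSI (1 ∷ []) S I n)) ⟶_)
    (sym (prodRatio-≡ S))
    (ratio⟶ S I (All.map <⇒≤ S>1) I≥1 (product S) (product (map suc S)) {{product-map-suc≢0 S}}
      (*-comm (product S) (product (map suc S))))) ,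
  (λ k I k≥2 _ I≥1 _ → ratio⟶ (twoTo k) I (twoTo-positive k) I≥1 2 (suc k) (twoTo-ratio (<⇒≤ k≥2)))
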